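{- Let $G=(X,E,\delta)$ be a connected graph with vertex set $X=\{x_1,\dots,x_m\}$ and positive edge lengths $\delta:E\to\mathbb{R}_{>0}$, and let $d_G$ be the induced shortest-path metric on $X$. Let $\omega\in\mathbb{R}_{>0}^m$, $\kappa\in\mathbb{R}_{>0}^k$ with $\sum_i\kappa_i=\sum_j\omega_j$, let $\xi\in BC$, $S=(s_1,\dots,s_k)\in X^k$, $\mu\in\mathbb{R}^k$, and let $d_i=d_G$ for $i=1,\dots,k$. If the generalized Voronoi diagram on the space $X$ with respect to $f_i(x)=d_G(s_i,x)+\mu_i$ supports $\xi$, then $\xi$ is $S$-star-shaped. In particular, $s_i\in\operatorname{supp}(C_i)$ for all $i\in\{1,\dots,k\}$.
   Context: $d_G(x,y)$ is the length of a shortest $x$-$y$ path in $G$ w.r.t. $\delta$. A (fractional) clustering is a matrix $\xi=(\xi_{i,j})\in[0,1]^{k\times m}$ with $\sum_i\xi_{i,j}=1$ for each $j$; cluster $i$ is the row $C_i$, with support $\operatorname{supp}(C_i)=\{x_j:\xi_{i,j}>0\}$. $BC$ is the set of clusterings with $\sum_j\xi_{i,j}\omega_j=\kappa_i$ for all $i$. The generalized Voronoi diagram w.r.t. $f_1,\dots,f_k:X\to\mathbb{R}$ is $P_i=\{x\in X: f_i(x)\le f_l(x)\ \forall l\}$; it supports $\xi$ if $\operatorname{supp}(C_i)=P_i$ for all $i$ (here the space is $X$ itself). $\xi$ is $S$-star-shaped if for every $i$ and every $x\in\operatorname{supp}(C_i)$, every vertex $v$ on a shortest $s_i$-$x$ path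 in $G$ satisfies $v\in\operatorname{supp}(C_i)$. -}

module Defs where

open import Level using (Level; _⊔_) renaming (suc to lsuc)
open import Data.Nat using (ℕ) renaming (zero to nzero; suc to nsuc)
open import Data.Fin using (Fin; zero; suc)
open import Data.Product using (Σ; _×_; _,_)
open import Data.Sum using (_⊎_)
open import Data.Empty using (⊥)
open import Relation.Nullary using (¬_)
open import Relation.Binary.PropositionalEquality using (_≡_; _≢_)

-- Ordered fields (the stdlib has no reals and no ordered-field bundle).
-- The theorem is stated over an arbitrary linearly ordered field F,
-- which includes F = ℝ as the case of the paper.

record OrderedField (c ℓ : Level) : Set (lsuc (c ⊔ ℓ)) where
  infixl 6 _+_
  infixl 7 _*_
  infix  4 _≤_
  field
    Carrier : Set c
    _+_ _*_ : Carrier → Carrier → Carrier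
    -_      : Carrier → Carrier
    0# 1#   : Carrier
    _≤_     : Carrier → Carrier → Set ℓ
    +-assoc : ∀ a b c → (a + b) + c ≡ a + (b + c)
    +-comm  : ∀ a b → a + b ≡ b + a
    +-identityˡ : ∀ a → 0# + a ≡ a
    -‿inverseˡ : ∀ a → (- a) + a ≡ 0#
    *-assoc : ∀ a b c → (a * b) * c ≡ a * (b * c)
    *-comm  : ∀ a b → a * b ≡ b * a
    *-identityˡ : ∀ a → 1# * a ≡ a
    distribˡ : ∀ a b c → a * (b + c) ≡ (a * b) + (a * c)
    0≢1 : 0# ≢ 1#
    inverse : ∀ a → a ≢ 0# → Σ Carrier (λ b → a * b ≡ 1#)
    ≤-refl    : ∀ a → a ≤ a
    ≤-trans   : ∀ {a b c} → a ≤ b → b ≤ c → a ≤ c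
    ≤-antisym : ∀ {a b} → a ≤ b → b ≤ a → a ≡ b
    ≤-total   : ∀ a b → (a ≤ b) ⊎ (b ≤ a)
    +-mono-≤  : ∀ {a b} c → a ≤ b → a + c ≤ b + c
    *-nonneg  : ∀ {a b} → 0# ≤ a → 0# ≤ b → 0# ≤ a * b

  infix 4 _<_
  _<_ : Carrier → Carrier → Set (c ⊔ ℓ)
  a < b = (a ≤ b) × (a ≢ b)

module _ {c ℓ : Level} (F : OrderedField c ℓ) where
  open OrderedField F

  ∑ : (n : ℕ) → (Fin n → Carrier) → Carrier
  ∑ nzero    f = 0#
  ∑ (nsuc n) f = f zero + ∑ n (λ j → f (suc j))

  record Graph (m : ℕ) : Set (lsuc (c ⊔ ℓ)) where
    field
      Edge    : Fin m → Fin m → Set c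
      sym     : ∀ {x y} → Edge x y → Edge y x
      δ       : ∀ {x y} → Edge x y → Carrier
      -- the length depends only on the (unordered) pair {x,y}
      δ-sym   : ∀ {x y} (e : Edge x y) (e' : Edge y x) → δ e ≡ δ e'
      δ-unique : ∀ {x y} (e e' : Edge x y) → δ e ≡ δ e'
      δ-pos   : ∀ {x y} (e : Edge x y) → 0# < δ e

  module _ {m : ℕ} (G : Graph m) where
    open Graph G

    data Path : Fin m → Fin m → Set c where
      []  : ∀ {x} → Path x x
      _∷_ : ∀ {x y z} → Edge x y → Path y z → Path x z

    len : ∀ {x y} → Path x y → Carrier
    len []       = 0#
    len (e ∷ p) = δ e + len p

    data OnPath (v : Fin m) : ∀ {x y} → Path x y → Set c where
      here-start : ∀ {y} (p : Path v y) → OnPath v p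
      there      : ∀ {x y z} (e : Edge x y) (p : Path y z) →
                   OnPath v p → OnPath v (e ∷ p)

    Connected : Set c
    Connected = ∀ x y → Path x y

    IsShortest : ∀ {x y} → Path x y → Set (c ⊔ ℓ)
    IsShortest {x} {y} p = ∀ (q : Path x y) → len p ≤ len q

    IsShortestPathMetric : (Fin m → Fin m → Carrier) → Set (c ⊔ ℓ)
    IsShortestPathMetric d =
      ∀ x y → Σ (Path x y) (λ p → len p ≡ d x y) ×
              (∀ (q : Path x y) → d x y ≤ len q)

  Clustering : ℕ → ℕ → Set c
  Clustering k m = Fin k → Fin m → Carrier

  IsClustering : ∀ {k m} → Clustering k m → Set (c ⊔ ℓ)
  IsClustering {k} {m} ξ =
    (∀ i j → (0# ≤ ξ i j) × (ξ i j ≤ 1#)) ×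
    (∀ j → ∑ k (λ i → ξ i j) ≡ 1#)

  InBC : ∀ {k m} → (Fin m → Carrier) → (Fin k → Carrier) →
         Clustering k m → Set (c ⊔ ℓ)
  InBC {k} {m} ω κ ξ =
    IsClustering ξ × (∀ i → ∑ m (λ j → ξ i j * ω j) ≡ κ i)

  Supp : ∀ {k m} → Clustering k m → Fin k → Fin m → Set (c ⊔ ℓ)
  Supp ξ i j = 0# < ξ i j

  VoronoiCell : ∀ {k m} → (Fin k → Fin m → Carrier) → Fin k → Fin m → Set ℓ
  VoronoiCell f i x = ∀ l → f i x ≤ f l x

  Supports : ∀ {k m} → (Fin k → Fin m → Carrier) → Clustering k m →
             Set (c ⊔ ℓ)
  Supports f ξ = ∀ i x → (Supp ξ i x → VoronoiCell f i x) ×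
                         (VoronoiCell f i x → Supp ξ i x)

  StarShaped : ∀ {k m} (G : Graph m) → (Fin k → Fin m) → Clustering k m →
               Set (c ⊔ ℓ)
  StarShaped G s ξ =
    ∀ i x → Supp ξ i x →
      ∀ (p : Path G (s i) x) → IsShortest G p →
      ∀ v → OnPath G v p → Supp ξ i v

-- Split a shortest s_i–x path at v into a then b.  Then
-- d(s_i,v) ≤ |a| = d(s_i,x) − |b|, whereas d(s_l,v) ≥ d(s_l,x) − |b| by the
-- triangle inequality, so v inherits every Voronoi inequality of x; hence
-- cells, and with them supports, are star-shaped around their sites.  A
-- cluster of mass κ_i ≠ 0 has a point x in its support, and s_i lies on the
-- shortest s_i–x path.
module Submission where

open import Defs
open import Level using (Level)
open import Data.Nat using (ℕ) renaming (zero to nzero; suc to nsuc)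
open import Data.Fin using (Fin; zero; suc)
open import Data.Product using (Σ; ∃; _×_; _,_; proj₁; proj₂)
open import Relation.Nullary using (¬_)
open import Relation.Binary.Bundles using (Preorder)
import Relation.Binary.Reasoning.Preorder
open import Relation.Binary.PropositionalEquality
  using (_≡_; _≢_; refl; sym; trans; cong; cong₂; subst; isEquivalence; module ≡-Reasoning)

module OrderedFieldProperties {c ℓ : Level} (F : OrderedField c ℓ) where
  open OrderedField F

  ≤-reflexive : ∀ {a b} → a ≡ b → a ≤ b
  ≤-reflexive {a} refl = ≤-refl a

  ≤-preorder : Preorder c c ℓ
  ≤-preorder = record
    { isPreorder = record
      { isEquivalence = isEquivalence
      ; reflexive     = ≤-reflexive
      ; trans         = ≤-trans
      }
    }

  +-identityʳ : ∀ a → a + 0# ≡ a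
  +-identityʳ a = trans (+-comm a 0#) (+-identityˡ a)

  +-swapʳ : ∀ a b c → (a + b) + c ≡ (a + c) + b
  +-swapʳ a b c = begin
    (a + b) + c  ≡⟨ +-assoc a b c ⟩
    a + (b + c)  ≡⟨ cong (a +_) (+-comm b c) ⟩
    a + (c + b)  ≡⟨ sym (+-assoc a c b) ⟩
    (a + c) + b  ∎
    where open ≡-Reasoning

  +-cancelʳ-≤ : ∀ {a b} c → a + c ≤ b + c → a ≤ b
  +-cancelʳ-≤ {a} {b} c a+c≤b+c =
    ≤-resp-≡ (+-mono-≤ (- c) a+c≤b+c) (+c-c a) (+c-c b)
    where
    +c-c : ∀ t → (t + c) + (- c) ≡ t
    +c-c t = begin
      (t + c) + (- c)  ≡⟨ +-assoc t c (- c) ⟩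
      t + (c + (- c))  ≡⟨ cong (t +_) (+-comm c (- c)) ⟩
      t + ((- c) + c)  ≡⟨ cong (t +_) (-‿inverseˡ c) ⟩
      t + 0#           ≡⟨ +-identityʳ t ⟩
      t                ∎
      where open ≡-Reasoning
    ≤-resp-≡ : ∀ {u u' w w'} → u ≤ w → u ≡ u' → w ≡ w' → u' ≤ w'
    ≤-resp-≡ u≤w refl refl = u≤w

  *-zeroˡ : ∀ a → 0# * a ≡ 0#
  *-zeroˡ a = begin
    0# * a                        ≡⟨ sym (+-identityˡ z) ⟩
    0# + z                        ≡⟨ cong (_+ z) (sym (-‿inverseˡ z)) ⟩
    ((- z) + z) + z               ≡⟨ +-assoc (- z) z z ⟩
    (- z) + (z + z)               ≡⟨ cong ((- z) +_) z+z≡z ⟩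
    (- z) + z                     ≡⟨ -‿inverseˡ z ⟩
    0#                            ∎
    where
    open ≡-Reasoning
    z = 0# * a
    z+z≡z : z + z ≡ z
    z+z≡z = begin
      z + z                  ≡⟨ cong₂ _+_ (*-comm 0# a) (*-comm 0# a) ⟩
      a * 0# + a * 0#        ≡⟨ sym (distribˡ a 0# 0#) ⟩
      a * (0# + 0#)          ≡⟨ cong (a *_) (+-identityˡ 0#) ⟩
      a * 0#                 ≡⟨ *-comm a 0# ⟩
      z                      ∎

  ∑≢0⇒¬¬∃≢0 : ∀ n (f : Fin n → Carrier) → ∑ F n f ≢ 0# → ¬ ¬ ∃ λ j → f j ≢ 0#
  ∑≢0⇒¬¬∃≢0 n f ∑f≢0 ∄ = ¬¬-∑≡0 n f (λ j fj≢0 → ∄ (j , fj≢0)) ∑f≢0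
    where
    ¬¬-∑≡0 : ∀ n (f : Fin n → Carrier) →
             (∀ j → ¬ ¬ f j ≡ 0#) → ¬ ¬ ∑ F n f ≡ 0#
    ¬¬-∑≡0 nzero    f _    ∑f≢0 = ∑f≢0 refl
    ¬¬-∑≡0 (nsuc n) f terms ∑f≢0 =
      terms zero λ f0≡0 →
      ¬¬-∑≡0 n (λ j → f (suc j)) (λ j → terms (suc j)) λ rest≡0 →
      ∑f≢0 (trans (cong₂ _+_ f0≡0 rest≡0) (+-identityˡ 0#))

module PathProperties {c ℓ : Level} (F : OrderedField c ℓ) {m : ℕ} (G : Graph F m) where
  open OrderedField F
  open Graph G using (δ)

  infixr 5 _++_
  _++_ : ∀ {x y z} → Path F G x y → Path F G y z → Path F G x z
  []      ++ q = q
  (e ∷ p) ++ q = e ∷ (p ++ q)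

  len-++ : ∀ {x y z} (p : Path F G x y) (q : Path F G y z) →
           len F G (p ++ q) ≡ len F G p + len F G q
  len-++ []      q = sym (+-identityˡ _)
  len-++ (e ∷ p) q = trans (cong (δ e +_) (len-++ p q)) (sym (+-assoc _ _ _))

  splitAt : ∀ {v x y} (p : Path F G x y) → OnPath F G v p →
            Σ (Path F G x v) λ a → Σ (Path F G v y) λ b →
              len F G p ≡ len F G a + len F G b
  splitAt p (here-start .p) = [] , p , sym (+-identityˡ _)
  splitAt (e ∷ p) (there e p v∈p) with splitAt p v∈p
  ... | a , b , p≡a+b = e ∷ a , b , trans (cong (δ e +_) p≡a+b) (sym (+-assoc _ _ _))

  module _ {d : Fin m → Fin m → Carrier} (d-metric : IsShortestPathMetric F G d) where

    d≤len : ∀ {x y} (p : Path F G x y) → d x y ≤ len F G p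
    d≤len {x} {y} = proj₂ (d-metric x y)

    shortestPath : ∀ x y → Path F G x y
    shortestPath x y = proj₁ (proj₁ (d-metric x y))

    len-shortestPath : ∀ x y → len F G (shortestPath x y) ≡ d x y
    len-shortestPath x y = proj₂ (proj₁ (d-metric x y))

    shortestPath-isShortest : ∀ x y → IsShortest F G (shortestPath x y)
    shortestPath-isShortest x y q =
      subst (_≤ len F G q) (sym (len-shortestPath x y)) (d≤len q)

    len-shortest≤d : ∀ {x y} (p : Path F G x y) → IsShortest F G p → len F G p ≤ d x y
    len-shortest≤d {x} {y} p p-shortest =
      subst (_ ≤_) (len-shortestPath x y) (p-shortest (shortestPath x y))

    d-triangleʳ : ∀ {x v y} (b : Path F G v y) → d x y ≤ d x v + len F G b
    d-triangleʳ {x} {v} b =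
      subst (_ ≤_) (trans (len-++ (shortestPath x v) b)
                          (cong (_+ len F G b) (len-shortestPath x v)))
            (d≤len (shortestPath x v ++ b))

module _ {c ℓ : Level} (F : OrderedField c ℓ) {m k : ℕ} (G : Graph F m)
         {d : Fin m → Fin m → OrderedField.Carrier F} (d-metric : IsShortestPathMetric F G d)
         (s : Fin k → Fin m) where
  open OrderedField F
  open OrderedFieldProperties F
  open PathProperties F G

  voronoiCell-starShaped :
    ∀ (μ : Fin k → Carrier) i {x} → VoronoiCell F (λ i x → d (s i) x + μ i) i x →
    ∀ (p : Path F G (s i) x) → IsShortest F G p →
    ∀ v → OnPath F G v p → VoronoiCell F (λ i x → d (s i) x + μ i) i v
  voronoiCell-starShaped μ i {x} x∈Pᵢ p p-shortest v v∈p l = +-cancelʳ-≤ B (begin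
    d (s i) v + μ i + B     ≲⟨ +-mono-≤ B (+-mono-≤ (μ i) (d≤len d-metric a)) ⟩
    A + μ i + B             ≡⟨ +-swapʳ A (μ i) B ⟩
    A + B + μ i             ≡⟨ cong (_+ μ i) (sym p≡a+b) ⟩
    len F G p + μ i         ≲⟨ +-mono-≤ (μ i) (len-shortest≤d d-metric p p-shortest) ⟩
    d (s i) x + μ i         ≲⟨ x∈Pᵢ l ⟩
    d (s l) x + μ l         ≲⟨ +-mono-≤ (μ l) (d-triangleʳ d-metric b) ⟩
    d (s l) v + B + μ l     ≡⟨ +-swapʳ (d (s l) v) B (μ l) ⟩
    d (s l) v + μ l + B     ∎)
    where
    open Relation.Binary.Reasoning.Preorder ≤-preorder
    a = proj₁ (splitAt p v∈p)
    b = proj₁ (proj₂ (splitAt p v∈p))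
    p≡a+b = proj₂ (proj₂ (splitAt p v∈p))
    A = len F G a
    B = len F G b

  supports⇒starShaped : ∀ (μ : Fin k → Carrier) (ξ : Clustering F k m) →
    Supports F (λ i x → d (s i) x + μ i) ξ → StarShaped F G s ξ
  supports⇒starShaped μ ξ supports i x x∈Cᵢ p p-shortest v v∈p =
    proj₂ (supports i v)
      (voronoiCell-starShaped μ i (proj₁ (supports i x) x∈Cᵢ) p p-shortest v v∈p)

  starShaped⇒site∈supp : ∀ {ξ : Clustering F k m} → StarShaped F G s ξ →
    ∀ i {x} → Supp F ξ i x → Supp F ξ i (s i)
  starShaped⇒site∈supp star i {x} x∈Cᵢ =
    star i x x∈Cᵢ (shortestPath d-metric (s i) x)
         (shortestPath-isShortest d-metric (s i) x)
         (s i) (here-start _)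

  -- Supp is (0 ≤ ξ) × (0 ≢ ξ), so given the first component it is ¬¬-stable.
  starShaped-mass≢0⇒site∈supp : ∀ (ω : Fin m → Carrier) {ξ : Clustering F k m} →
    StarShaped F G s ξ → ∀ i → (∀ j → 0# ≤ ξ i j) →
    ∑ F m (λ j → ξ i j * ω j) ≢ 0# → Supp F ξ i (s i)
  starShaped-mass≢0⇒site∈supp ω {ξ} star i ξᵢ≥0 mass≢0 =
    ξᵢ≥0 (s i) , λ 0≡ξᵢsᵢ →
      ∑≢0⇒¬¬∃≢0 m (λ j → ξ i j * ω j) mass≢0 λ where
        (j , ξᵢⱼωⱼ≢0) →
          let j∈Cᵢ : Supp F ξ i j
              j∈Cᵢ = ξᵢ≥0 j , λ 0≡ξᵢⱼ →
                ξᵢⱼωⱼ≢0 (trans (cong (_* ω j) (sym 0≡ξᵢⱼ)) (*-zeroˡ (ω j)))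
          in proj₂ (starShaped⇒site∈supp star i j∈Cᵢ) 0≡ξᵢsᵢ

theorem5 : ∀ {c ℓ : Level} (F : OrderedField c ℓ) → let open OrderedField F in
    ∀ {m k : ℕ} (G : Graph F m) → Connected F G →
    (d : Fin m → Fin m → Carrier) → IsShortestPathMetric F G d →
    (ω : Fin m → Carrier) → (∀ j → 0# < ω j) →
    (κ : Fin k → Carrier) → (∀ i → 0# < κ i) →
    ∑ F k κ ≡ ∑ F m ω →
    (ξ : Clustering F k m) → InBC F ω κ ξ →
    (s : Fin k → Fin m) → (μ : Fin k → Carrier) →
    Supports F (λ i x → d (s i) x + μ i) ξ →
    StarShaped F G s ξ × (∀ i → Supp F ξ i (s i))
theorem5 F G _ d d-metric ω _ κ κ>0 _ ξ ((ξ-bounds , _) , mass≡κ) s μ supports =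
  star , site∈supp
  where
  open OrderedField F
  star : StarShaped F G s ξ
  star = supports⇒starShaped F G d-metric s μ ξ supports
  site∈supp : ∀ i → Supp F ξ i (s i)
  site∈supp i = starShaped-mass≢0⇒site∈supp F G d-metric s ω star i
    (λ j → proj₁ (ξ-bounds i j))
    (λ mass≡0 → proj₂ (κ>0 i) (sym (trans (sym (mass≡κ i)) mass≡0)))
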